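{- Let $\mathbf L=(L,\lor,\land,*,1)$ be a lattice equipped with a binary operation $*$ and a constant $1$, and let $\leq$ be its lattice order. Then $\mathbf L$ is a lattice skew Hilbert algebra if and only if it satisfies the following identities: (L1) $x*(x\lor y)\approx 1$; (L2) $x*((x*y)*y)\approx 1$; (L3) $((x\lor y)*z)*(x*z)\approx 1$; (L4) $(x\lor y)\land(x*y)\approx y$.
   Context: For a poset $(P,\leq)$ and $A\subseteq P$ let $L(A)=\{x\in P: x\leq a \text{ for all } a\in A\}$ and $U(A)=\{x\in P: x\geq a\text{ for all }a\in A\}$; write $L(a,b)$ for $L(\{a,b\})$, $U(a,b)$ for $U(\{a,b\})$, and $L(U(x,y),z)$ for $L(U(\{x,y\})\cup\{z\})$. A skew Hilbert algebra is a poset $(S,\leq,*,1)$ with a binary operation $*$ and a constant $1$ such that for all $x,y,z\in S$: (S1) $x\leq y$ iff $x*y=1$; (S2) if $y*x=1$ then $x*((x*y)*y)=1$; (S3) if $x*y=1$ then $(y*z)*(x*z)=1$; (S4) $L(U(x,y),x*y)=L(y)$. A lattice skew Hilbert algebra is a structure $(S,\leq,*,1)$ such that $(S,\leq)$ is a lattice and (S1), (S3), (S4) hold together with (S2'): $x*((x*y)*y)=1$ for all $x,y$. -}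

module Defs where

open import Level using (Level)
open import Data.Product using (_×_)
open import Relation.Binary.PropositionalEquality using (_≡_)
open import Algebra.Core using (Op₂)
open import Algebra.Lattice.Structures using (IsLattice)

record LatticeWithImp (a : Level) : Set (Level.suc a) where
  field
    Carrier   : Set a
    _∨_       : Op₂ Carrier
    _∧_       : Op₂ Carrier
    _*_       : Op₂ Carrier
    one       : Carrier
    isLattice : IsLattice _≡_ _∨_ _∧_

  infixr 5 _*_
  infixr 6 _∨_
  infixr 7 _∧_

  _≤_ : Carrier → Carrier → Set a
  x ≤ y = x ∨ y ≡ y

  U₂ : Carrier → Carrier → Carrier → Set a
  U₂ x y u = (x ≤ u) × (y ≤ u)

  -- L(U(x,y) ∪ {z}) = { w : w ≤ u for all u ∈ U(x,y), and w ≤ z }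
  LUz : Carrier → Carrier → Carrier → Carrier → Set a
  LUz x y z w = (∀ u → U₂ x y u → w ≤ u) × (w ≤ z)

  L₁ : Carrier → Carrier → Set a
  L₁ y w = w ≤ y

  S1 : Set a
  S1 = ∀ x y → (x ≤ y → x * y ≡ one) × (x * y ≡ one → x ≤ y)

  S2' : Set a
  S2' = ∀ x y → x * ((x * y) * y) ≡ one

  S3 : Set a
  S3 = ∀ x y z → x * y ≡ one → (y * z) * (x * z) ≡ one

  -- (S4): L(U(x,y), x*y) = L(y) as sets
  S4 : Set a
  S4 = ∀ x y w → (LUz x y (x * y) w → L₁ y w) × (L₁ y w → LUz x y (x * y) w)

  IsLatticeSkewHilbert : Set a
  IsLatticeSkewHilbert = S1 × S2' × S3 × S4

  IdentitiesL : Set a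
  IdentitiesL =
    (∀ x y → x * (x ∨ y) ≡ one) ×
    (∀ x y → x * ((x * y) * y) ≡ one) ×
    (∀ x y z → ((x ∨ y) * z) * (x * z) ≡ one) ×
    (∀ x y → (x ∨ y) ∧ (x * y) ≡ y)

-- In a lattice L(U(x,y)) is the down-set of x ∨ y, so L(U(x,y), x*y) is the
-- down-set of (x ∨ y) ∧ (x*y), and (S4) says exactly that this element is y,
-- which is (L4). Given (L1) and (L4), z ≤ z*z = 1 makes 1 the top element, so
-- x*y = 1 gives x ≤ x ∨ y = (x ∨ y) ∧ (x*y) = y: this is the hard half of
-- (S1). The rest is bookkeeping, since (L1) and (L3) are the instances
-- y := x ∨ y of (S1) and (S3).
module Submission where

open import Defs
open import Level using (Level)
open import Data.Product using (_×_; _,_; proj₁; proj₂)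
open import Relation.Binary.PropositionalEquality using (_≡_; sym; cong; subst; isEquivalence; module ≡-Reasoning)
open import Algebra.Lattice.Bundles using (Lattice)
open import Algebra.Lattice.Structures using (IsLattice)
import Algebra.Lattice.Properties.Lattice as LatticeProperties
import Relation.Binary.Lattice as Order

module LatticeOrder {a : Level} (𝐋 : LatticeWithImp a) where
  open LatticeWithImp 𝐋
  open IsLattice isLattice using (∨-comm; ∧-comm; ∨-absorbs-∧; ∧-absorbs-∨)
  open ≡-Reasoning

  lattice : Lattice a a
  lattice = record { isLattice = isLattice }

  open LatticeProperties lattice using (∨-∧-orderTheoreticLattice)
  -- The library orders an algebraic lattice by x ≡ x ∧ y; Defs uses x ∨ y ≡ y.
  open Order.Lattice ∨-∧-orderTheoreticLattice using ()
    renaming (_≤_ to _⊑_; isLattice to ⊑-isLattice)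

  ≤⇒⊑ : ∀ {x y} → x ≤ y → x ⊑ y
  ≤⇒⊑ {x} {y} x∨y≡y = begin
    x             ≡⟨ ∧-absorbs-∨ x y ⟨
    x ∧ (x ∨ y)   ≡⟨ cong (x ∧_) x∨y≡y ⟩
    x ∧ y         ∎

  ⊑⇒≤ : ∀ {x y} → x ⊑ y → x ≤ y
  ⊑⇒≤ {x} {y} x≡x∧y = begin
    x ∨ y         ≡⟨ cong (_∨ y) x≡x∧y ⟩
    (x ∧ y) ∨ y   ≡⟨ ∨-comm (x ∧ y) y ⟩
    y ∨ (x ∧ y)   ≡⟨ cong (y ∨_) (∧-comm x y) ⟩
    y ∨ (y ∧ x)   ≡⟨ ∨-absorbs-∧ y x ⟩
    y             ∎

  ≤-isLattice : Order.IsLattice _≡_ _≤_ _∨_ _∧_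
  ≤-isLattice = record
    { isPartialOrder = record
      { isPreorder = record
        { isEquivalence = isEquivalence
        ; reflexive     = λ x≡y → ⊑⇒≤ (reflexive x≡y)
        ; trans         = λ x≤y y≤z → ⊑⇒≤ (trans (≤⇒⊑ x≤y) (≤⇒⊑ y≤z))
        }
      ; antisym = λ x≤y y≤x → antisym (≤⇒⊑ x≤y) (≤⇒⊑ y≤x)
      }
    ; supremum = λ x y → let x⊑ , y⊑ , least = supremum x y in
        ⊑⇒≤ x⊑ , ⊑⇒≤ y⊑ , λ z x≤z y≤z → ⊑⇒≤ (least z (≤⇒⊑ x≤z) (≤⇒⊑ y≤z))
    ; infimum = λ x y → let ⊑x , ⊑y , greatest = infimum x y in
        ⊑⇒≤ ⊑x , ⊑⇒≤ ⊑y , λ z z≤x z≤y → ⊑⇒≤ (greatest z (≤⇒⊑ z≤x) (≤⇒⊑ z≤y))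
    }
    where open Order.IsLattice ⊑-isLattice using (reflexive; trans; antisym; supremum; infimum)

  open Order.IsLattice ≤-isLattice public
    using (x≤x∨y; y≤x∨y; ∨-least; x∧y≤x; x∧y≤y; ∧-greatest)
    renaming (refl to ≤-refl; trans to ≤-trans; antisym to ≤-antisym)

  ≡-from-down-sets : ∀ {b c} → (∀ w → (w ≤ b → w ≤ c) × (w ≤ c → w ≤ b)) → b ≡ c
  ≡-from-down-sets {b} {c} same = ≤-antisym (proj₁ (same b) ≤-refl) (proj₂ (same c) ≤-refl)

  x∨y∈U₂ : ∀ x y → U₂ x y (x ∨ y)
  x∨y∈U₂ x y = x≤x∨y x y , y≤x∨y x y

  LUz⇒≤∨∧ : ∀ {x y z w} → LUz x y z w → w ≤ ((x ∨ y) ∧ z)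
  LUz⇒≤∨∧ {x} {y} (≤U , w≤z) = ∧-greatest (≤U (x ∨ y) (x∨y∈U₂ x y)) w≤z

  ≤∨∧⇒LUz : ∀ {x y z w} → w ≤ ((x ∨ y) ∧ z) → LUz x y z w
  ≤∨∧⇒LUz w≤ =
    (λ u (x≤u , y≤u) → ≤-trans w≤ (≤-trans (x∧y≤x _ _) (∨-least x≤u y≤u))) ,
    ≤-trans w≤ (x∧y≤y _ _)

module SkewHilbert {a : Level} (𝐋 : LatticeWithImp a) where
  open LatticeWithImp 𝐋
  open LatticeOrder 𝐋

  L1 L3 L4 : Set a
  L1 = ∀ x y → x * (x ∨ y) ≡ one
  L3 = ∀ x y z → ((x ∨ y) * z) * (x * z) ≡ one
  L4 = ∀ x y → (x ∨ y) ∧ (x * y) ≡ y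

  S4⇒L4 : S4 → L4
  S4⇒L4 s4 x y = ≡-from-down-sets λ w →
    (λ w≤ → proj₁ (s4 x y w) (≤∨∧⇒LUz w≤)) ,
    (λ w≤y → LUz⇒≤∨∧ (proj₂ (s4 x y w) w≤y))

  L4⇒S4 : L4 → S4
  L4⇒S4 l4 x y w =
    (λ h → subst (w ≤_) (l4 x y) (LUz⇒≤∨∧ h)) ,
    (λ w≤y → ≤∨∧⇒LUz (subst (w ≤_) (sym (l4 x y)) w≤y))

  x≤y⇒x*y≡one : L1 → ∀ {x y} → x ≤ y → x * y ≡ one
  x≤y⇒x*y≡one l1 {x} {y} x∨y≡y = subst (λ t → x * t ≡ one) x∨y≡y (l1 x y)

  one-isTop : L1 → L4 → ∀ z → z ≤ one
  one-isTop l1 l4 z = subst (z ≤_) (x≤y⇒x*y≡one l1 ≤-refl) z≤z*z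
    where
    z≤z*z : z ≤ (z * z)
    z≤z*z = subst (_≤ (z * z)) (l4 z z) (x∧y≤y (z ∨ z) (z * z))

  x*y≡one⇒x≤y : L1 → L4 → ∀ {x y} → x * y ≡ one → x ≤ y
  x*y≡one⇒x≤y l1 l4 {x} {y} x*y≡one =
    ≤-trans (x≤x∨y x y) (subst ((x ∨ y) ≤_) (l4 x y) x∨y≤x∨y∧x*y)
    where
    x∨y≤x*y : (x ∨ y) ≤ (x * y)
    x∨y≤x*y = subst ((x ∨ y) ≤_) (sym x*y≡one) (one-isTop l1 l4 (x ∨ y))

    x∨y≤x∨y∧x*y : (x ∨ y) ≤ ((x ∨ y) ∧ (x * y))
    x∨y≤x∨y∧x*y = ∧-greatest ≤-refl x∨y≤x*y

  L1×L4⇒S1 : L1 → L4 → S1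
  L1×L4⇒S1 l1 l4 x y = x≤y⇒x*y≡one l1 , x*y≡one⇒x≤y l1 l4

  S1⇒L1 : S1 → L1
  S1⇒L1 s1 x y = proj₁ (s1 x (x ∨ y)) (x≤x∨y x y)

  S1×S3⇒L3 : S1 → S3 → L3
  S1×S3⇒L3 s1 s3 x y z = s3 x (x ∨ y) z (S1⇒L1 s1 x y)

  S1×L3⇒S3 : S1 → L3 → S3
  S1×L3⇒S3 s1 l3 x y z x*y≡one =
    subst (λ t → (t * z) * (x * z) ≡ one) (proj₂ (s1 x y) x*y≡one) (l3 x y z)

mainTheorem1 : ∀ {a : Level} (𝐋 : LatticeWithImp a) →
    (LatticeWithImp.IsLatticeSkewHilbert 𝐋 → LatticeWithImp.IdentitiesL 𝐋) ×
    (LatticeWithImp.IdentitiesL 𝐋 → LatticeWithImp.IsLatticeSkewHilbert 𝐋)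
mainTheorem1 𝐋 = identities , skewHilbert
  where
  open LatticeWithImp 𝐋 using (S1; IdentitiesL; IsLatticeSkewHilbert)
  open SkewHilbert 𝐋

  identities : IsLatticeSkewHilbert → IdentitiesL
  identities (s1 , s2 , s3 , s4) = S1⇒L1 s1 , s2 , S1×S3⇒L3 s1 s3 , S4⇒L4 s4

  skewHilbert : IdentitiesL → IsLatticeSkewHilbert
  skewHilbert (l1 , l2 , l3 , l4) = s1 , l2 , S1×L3⇒S3 s1 l3 , L4⇒S4 l4
    where
    s1 : S1
    s1 = L1×L4⇒S1 l1 l4
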